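{- There is a term $\mathbf{Exp}$ such that $\mathbf{Exp}\,\ulcorner n\urcorner\leadsto^*\ulcorner 2^n\urcorner$ for every $n\in\mathbb{N}$, and $\vdash\mathbf{Exp}:\mathbb{U}^{i+2}\multimap\mathbb{U}^i$ is derivable in $\mathsf{RH}(\mathsf{A})$ for every $i\in\mathbb{N}$.
   Context: Free algebras: a free algebra $\mathbb{A}=(\mathcal{C}_\mathbb{A},\mathcal{R}_\mathbb{A})$: finite constructor set $\{c^\mathbb{A}_1,\dots,c^\mathbb{A}_{k(\mathbb{A})}\}$ with arities. $\mathscr{A}$ is a fixed finite family of free algebras with pairwise disjoint constructor sets containing: $\mathbb{U}$ ($c_1^\mathbb{U}$ unary, $c_2^\mathbb{U}$ nullary), $\mathbb{B}$ ($c_1^\mathbb{B},c_2^\mathbb{B}$ unary, $c_3^\mathbb{B}$ nullary), $\mathbb{C}$ ($c_1^\mathbb{C}$ binary, $c_2^\mathbb{C}$ nullary), $\mathbb{D}$ ($c_1^\mathbb{D},c_2^\mathbb{D}$ binary, $c_3^\mathbb{D}$ nullary). Numerals: $\ulcorner 0\urcorner=c_2^\mathbb{U}$, $\ulcorner n+1\urcorner=c_1^\mathbb{U}\ulcorner n\urcorner$. Terms: $M::=x\mid c\mid MM\mid \lambda x.M\mid M\{\!\{M,\dots,M\}\!\}\mid M\langle\!\langle M,\dots,M\rangle\!\rangle$. Types: $A::=\mathbb{A}^n\mid A\multimap A$. $A\multimap^0B=B$, $A\multimap^{n+1}B=A\multimap(A\multimap^nB)$; level $V(\mathbb{A}^n)=n$,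 $V(A\multimap B)=\max\{V(A),V(B)\}$. Typing rules: (A) $x:A\vdash x:A$; (W) from $\Gamma\vdash M:B$ infer $\Gamma,x:A\vdash M:B$; (C) from $\Gamma,x:A,y:A\vdash M:B$ infer $\Gamma,z:A\vdash M\{z/x,z/y\}:B$; ($I_\multimap$) from $\Gamma,x:A\vdash M:B$ infer $\Gamma\vdash\lambda x.M:A\multimap B$; ($E_\multimap$) from $\Gamma\vdash M:A\multimap B$, $\Delta\vdash N:A$ infer $\Gamma,\Delta\vdash MN:B$; ($I_\mathbb{A}$) $\vdash c:\mathbb{A}^n\multimap^{\mathcal{R}(c)}\mathbb{A}^n$; ($E^C_\mathbb{A}$) from $\Gamma_i\vdash M_{c^\mathbb{A}_i}:\mathbb{A}^m\multimap^{\mathcal{R}(c^\mathbb{A}_i)}C$ and $\Delta\vdash L:\mathbb{A}^m$ infer $\Gamma_1,\dots,\Gamma_{k(\mathbb{A})},\Delta\vdash L\{\!\{M_{c_1^\mathbb{A}},\dots\}\!\}:C$; ($E^R_\mathbb{A}$) from $\Gamma_i\vdash M_{c^\mathbb{A}_i}:\mathbb{A}^m\multimap^{\mathcal{R}(c^\mathbb{A}_i)}(C\multimap^{\mathcal{R}(c^\mathbb{A}_i)}C)$ and $\Delta\vdash L:\mathbb{A}^m$ infer $\Gamma_1,\dots,\Gamma_{k(\mathbb{A})},\Delta\vdash L\langle\!\langle M_{c_1^\mathbb{A}},\dots\rangle\!\rangle:C$. Let $\mathsf{A}=\{\mathbb{A}^n:\mathbb{A}\in\mathscr{A},n\in\mathbb{N}\}$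 (all base types). The system $\mathsf{RH}(\mathsf{A})$ uses these rules, allowing rule (C) only when the contracted type is in $\mathsf{A}$, requiring all types in each $\Gamma_i$ of $E^R_\mathbb{A}$ to be in $\mathsf{A}$, and adding to $E^R_\mathbb{A}$ the premise $m>V(C)$. Values $V::=x\mid\lambda x.M\mid T$, $T::=c\mid TT$. Reduction $\to$: $(\lambda x.M)V\to M\{V/x\}$; $c_i^\mathbb{A}t_1\cdots t_r\{\!\{M_{c_1},\dots,M_{c_k}\}\!\}\to M_{c_i}t_1\cdots t_r$; $c_i^\mathbb{A}t_1\cdots t_r\langle\!\langle\vec M\rangle\!\rangle\to M_{c_i}t_1\cdots t_r(t_1\langle\!\langle\vec M\rangle\!\rangle)\cdots(t_r\langle\!\langle\vec M\rangle\!\rangle)$ with $r=\mathcal{R}(c_i^\mathbb{A})$, $t_j$ constructor terms. $\leadsto$ is the closure of $\to$ under application contexts on both sides and under the scrutinee position of conditionals/recursions (not under $\lambda$, not inside branches); $\leadsto^*$ its reflexive-transitive closure. -}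

module Defs where

open import Data.Nat using (ℕ; zero; suc; _⊔_; _<_; _≟_; _^_)
open import Data.Fin using (Fin; toℕ) renaming (zero to fz; suc to fs)
open import Data.List using (List; []; _∷_; _++_; map; length; lookup)
open import Data.List.Relation.Unary.All using (All)
open import Data.List.Membership.Propositional using (_∉_)
open import Data.List.Relation.Binary.Permutation.Propositional using (_↭_)
open import Data.Product using (_×_; _,_; proj₁; proj₂)
open import Data.Maybe using (Maybe; just; nothing)
open import Data.Unit using (⊤)
open import Relation.Nullary using (yes; no)
open import Relation.Binary.PropositionalEquality using (_≡_)
open import Relation.Binary.Construct.Closure.ReflexiveTransitive using (Star)

-- A family consists of the four distinguished algebras 𝕌, 𝔹, ℂ, 𝔻 plus
-- an arbitrary finite number n of further free algebras, each given by
-- the list of arities of its constructors.  A constructor is a pair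
-- (algebra, index), so constructor sets are automatically disjoint.

record Family : Set where
  field
    nExtra    : ℕ
    extraAr   : Fin nExtra → List ℕ

module Lang (F : Family) where
  open Family F

  data Alg : Set where
    𝕌 𝔹 ℂ 𝔻 : Alg
    extra   : Fin nExtra → Alg

  arityOf : Alg → List ℕ
  arityOf 𝕌 = 1 ∷ 0 ∷ []
  arityOf 𝔹 = 1 ∷ 1 ∷ 0 ∷ []
  arityOf ℂ = 2 ∷ 0 ∷ []
  arityOf 𝔻 = 2 ∷ 2 ∷ 0 ∷ []
  arityOf (extra j) = extraAr j

  k : Alg → ℕ
  k a = length (arityOf a)

  -- constructor index (0-based: Fin position i stands for c_{i+1})
  CIdx : Alg → Set
  CIdx a = Fin (k a)

  R : (a : Alg) → CIdx a → ℕ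
  R a i = lookup (arityOf a) i

  Var : Set
  Var = ℕ

  data Term : Set where
    var  : Var → Term
    con  : (a : Alg) → CIdx a → Term
    app  : Term → Term → Term
    lam  : Var → Term → Term
    cond : Term → List Term → Term
    rec  : Term → List Term → Term

  spine : Term → List Term → Term
  spine M []       = M
  spine M (N ∷ Ns) = spine (app M N) Ns

  mutual
    vars : Term → List Var
    vars (var x)     = x ∷ []
    vars (con a i)   = []
    vars (app M N)   = vars M ++ vars N
    vars (lam x M)   = x ∷ vars M
    vars (cond L Ms) = vars L ++ varsL Ms
    vars (rec L Ms)  = vars L ++ varsL Ms

    varsL : List Term → List Var
    varsL []       = []
    varsL (M ∷ Ms) = vars M ++ varsL Ms

  -- M{N/x} (substitution; capture-free whenever N is closed, which is
  -- always the case for the weak reduction of closed terms)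
  mutual
    _[_/_] : Term → Term → Var → Term
    var y [ N / x ] with x ≟ y
    ... | yes _ = N
    ... | no  _ = var y
    con a i [ N / x ] = con a i
    app M₁ M₂ [ N / x ] = app (M₁ [ N / x ]) (M₂ [ N / x ])
    lam y M [ N / x ] with x ≟ y
    ... | yes _ = lam y M
    ... | no  _ = lam y (M [ N / x ])
    cond L Ms [ N / x ] = cond (L [ N / x ]) (substL Ms N x)
    rec L Ms [ N / x ] = rec (L [ N / x ]) (substL Ms N x)

    substL : List Term → Term → Var → List Term
    substL [] N x = []
    substL (M ∷ Ms) N x = (M [ N / x ]) ∷ substL Ms N x

  infixr 5 _⊸_
  data Ty : Set where
    base : Alg → ℕ → Ty
    _⊸_  : Ty → Ty → Ty

  _⊸^[_]_ : Ty → ℕ → Ty → Ty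
  A ⊸^[ zero ]  B = B
  A ⊸^[ suc n ] B = A ⊸ (A ⊸^[ n ] B)

  V : Ty → ℕ
  V (base a n) = n
  V (A ⊸ B)    = V A ⊔ V B

  data IsBase : Ty → Set where
    isBase : ∀ a n → IsBase (base a n)

  -- Contexts: lists of (variable, type); "Γ, Δ" is concatenation,
  -- "Γ, x:A" is Γ ++ [(x , A)]; contexts are taken up to permutation
  -- (exchange rule), and all variables in a context are distinct.

  Ctx : Set
  Ctx = List (Var × Ty)

  dom : Ctx → List Var
  dom Γ = map proj₁ Γ

  Disjoint : Ctx → Ctx → Set
  Disjoint Γ Δ = All (λ p → proj₁ p ∉ dom Δ) Γ

  AllBase : Ctx → Set
  AllBase Γ = All (λ p → IsBase (proj₂ p)) Γ

  infix 4 _⊢_∶_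
  mutual
    data _⊢_∶_ : Ctx → Term → Ty → Set where
      -- exchange (contexts are multisets in the paper)
      ex  : ∀ {Γ Γ' M B} → Γ ↭ Γ' → Γ ⊢ M ∶ B → Γ' ⊢ M ∶ B
      ax  : ∀ {x A} → ((x , A) ∷ []) ⊢ var x ∶ A
      wk  : ∀ {Γ M B x A} → x ∉ dom Γ → Γ ⊢ M ∶ B →
            (Γ ++ (x , A) ∷ []) ⊢ M ∶ B
      ctr : ∀ {Γ M B x y z A} → IsBase A → z ∉ dom Γ → z ∉ vars M →
            (Γ ++ (x , A) ∷ (y , A) ∷ []) ⊢ M ∶ B →
            (Γ ++ (z , A) ∷ []) ⊢ ((M [ var z / x ]) [ var z / y ]) ∶ B
      lamI : ∀ {Γ M A B x} → (Γ ++ (x , A) ∷ []) ⊢ M ∶ B → Γ ⊢ lam x M ∶ A ⊸ B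
      appE : ∀ {Γ Δ M N A B} → Γ ⊢ M ∶ A ⊸ B → Δ ⊢ N ∶ A → Disjoint Γ Δ →
             (Γ ++ Δ) ⊢ app M N ∶ B
      conI : ∀ {a i n} → [] ⊢ con a i ∶ (base a n ⊸^[ R a i ] base a n)
      condE : ∀ {a m C Γ Δ Ms L} →
              Branches (λ _ → ⊤) (λ r → base a m ⊸^[ r ] C) (arityOf a) Ms Γ →
              Δ ⊢ L ∶ base a m → Disjoint Γ Δ →
              (Γ ++ Δ) ⊢ cond L Ms ∶ C
      recE : ∀ {a m C Γ Δ Ms L} →
             Branches AllBase (λ r → base a m ⊸^[ r ] (C ⊸^[ r ] C)) (arityOf a) Ms Γ →
             Δ ⊢ L ∶ base a m → Disjoint Γ Δ → V C < m →
             (Γ ++ Δ) ⊢ rec L Ms ∶ C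

    -- premises Γᵢ ⊢ M_{cᵢ} : T(𝓡(cᵢ)) for i = 1..k, with Γ = Γ₁,…,Γₖ
    data Branches (P : Ctx → Set) (T : ℕ → Ty) : List ℕ → List Term → Ctx → Set where
      []  : Branches P T [] [] []
      cons : ∀ {r rs M Ms Γ Γ'} → Γ ⊢ M ∶ T r → P Γ →
             Branches P T rs Ms Γ' → Disjoint Γ Γ' →
             Branches P T (r ∷ rs) (M ∷ Ms) (Γ ++ Γ')

  data IsCT : Term → Set where
    ctCon : ∀ a i → IsCT (con a i)
    ctApp : ∀ {S T} → IsCT S → IsCT T → IsCT (app S T)

  data IsValue : Term → Set where
    vVar : ∀ x → IsValue (var x)
    vLam : ∀ x M → IsValue (lam x M)
    vCT  : ∀ {T} → IsCT T → IsValue T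

  _at_ : List Term → ℕ → Maybe Term
  []       at n     = nothing
  (M ∷ Ms) at zero  = just M
  (M ∷ Ms) at suc n = Ms at n

  infix 4 _⟶_ _⇝_ _⇝*_
  data _⟶_ : Term → Term → Set where
    β    : ∀ {x M W} → IsValue W → app (lam x M) W ⟶ (M [ W / x ])
    ιC   : ∀ {a i ts Ms M} → length ts ≡ R a i → All IsCT ts →
           length Ms ≡ k a → Ms at toℕ i ≡ just M →
           cond (spine (con a i) ts) Ms ⟶ spine M ts
    ιR   : ∀ {a i ts Ms M} → length ts ≡ R a i → All IsCT ts →
           length Ms ≡ k a → Ms at toℕ i ≡ just M →
           rec (spine (con a i) ts) Ms ⟶
             spine (spine M ts) (map (λ t → rec t Ms) ts)

  data _⇝_ : Term → Term → Set where
    step  : ∀ {M N} → M ⟶ N → M ⇝ N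
    appL  : ∀ {M M' N} → M ⇝ M' → app M N ⇝ app M' N
    appR  : ∀ {M N N'} → N ⇝ N' → app M N ⇝ app M N'
    condS : ∀ {L L' Ms} → L ⇝ L' → cond L Ms ⇝ cond L' Ms
    recS  : ∀ {L L' Ms} → L ⇝ L' → rec L Ms ⇝ rec L' Ms

  _⇝*_ : Term → Term → Set
  _⇝*_ = Star _⇝_

  -- numerals ⌜n⌝ : c₂^𝕌 is nullary (index 1), c₁^𝕌 unary (index 0)
  ⌜_⌝ : ℕ → Term
  ⌜ zero ⌝  = con 𝕌 (fs fz)
  ⌜ suc n ⌝ = app (con 𝕌 fz) ⌜ n ⌝

{-# OPTIONS --safe #-}
-- The first recursion unfolds ⌜n⌝ into the complete
-- binary tree of depth n in ℂ; copying a subtree is legal because it has base type ℂ, so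
-- contraction applies.  The second recursion sends a leaf to the successor and a node to the
-- composition of the functions of its two subtrees, so the tree becomes a closed term adding 2ⁿ,
-- which is finally applied to ⌜0⌝.  Typing the recursions as 𝕌^(i+2) → ℂ^(i+1) and
-- ℂ^(i+1) → (𝕌^i ⊸ 𝕌^i) makes each scrutinee level exceed the level of the result.
module Submission where

open import Defs
open import Data.Nat using (ℕ; zero; suc; _+_; _^_; _<_; _≟_; z<s)
open import Data.Nat.Properties using (+-assoc; +-identityʳ; +-monoʳ-<; n<1+n; m<m+n; ⊔-pres-<m)
open import Data.List using (List; []; _∷_)
open import Data.List.Relation.Unary.All using ([]; _∷_)
open import Data.List.Membership.Propositional using (_∉_)
open import Data.List.Membership.DecPropositional _≟_ using (_∈?_)
open import Data.List.Relation.Binary.Permutation.Propositional.Properties using (++-comm)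
open import Data.Product using (Σ; _×_; _,_)
open import Data.Fin using () renaming (zero to fz; suc to fs)
open import Relation.Nullary using (yes; no; contradiction)
open import Relation.Nullary.Decidable using (False; toWitnessFalse)
open import Relation.Binary.PropositionalEquality using (_≡_; _≢_; refl; sym; cong; cong₂; subst; subst₂)
open import Relation.Binary.Construct.Closure.ReflexiveTransitive using (ε; _◅_; _◅◅_; gmap)

module _ (F : Family) where
  open Lang F

  succ node leaf : Term
  succ = con 𝕌 fz
  node = con ℂ fz
  leaf = con ℂ (fs fz)

  fullTree : ℕ → Term
  fullTree zero    = leaf
  fullTree (suc n) = app (app node (fullTree n)) (fullTree n)

  ⌜⌝-isCT : ∀ n → IsCT ⌜ n ⌝
  ⌜⌝-isCT zero    = ctCon 𝕌 (fs fz)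
  ⌜⌝-isCT (suc n) = ctApp (ctCon 𝕌 fz) (⌜⌝-isCT n)

  fullTree-isCT : ∀ n → IsCT (fullTree n)
  fullTree-isCT zero    = ctCon ℂ (fs fz)
  fullTree-isCT (suc n) = ctApp (ctApp (ctCon ℂ fz) (fullTree-isCT n)) (fullTree-isCT n)

  appL* : ∀ {M M′ N} → M ⇝* M′ → app M N ⇝* app M′ N
  appL* = gmap _ appL

  appR* : ∀ {M N N′} → N ⇝* N′ → app M N ⇝* app M N′
  appR* = gmap _ appR

  recS* : ∀ {L L′ Ms} → L ⇝* L′ → rec L Ms ⇝* rec L′ Ms
  recS* = gmap _ recS

  Closed : Term → Set
  Closed M = ∀ N x → M [ N / x ] ≡ M

  var-subst-≢ : ∀ {N x y} → x ≢ y → var y [ N / x ] ≡ var y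
  var-subst-≢ {x = x} {y} x≢y with x ≟ y
  ... | yes x≡y = contradiction x≡y x≢y
  ... | no  _   = refl

  lam-closed : ∀ {y M} → (∀ {N x} → x ≢ y → M [ N / x ] ≡ M) → Closed (lam y M)
  lam-closed {y} closed-off-y N x with x ≟ y
  ... | yes _   = refl
  ... | no  x≢y = cong (lam y) (closed-off-y x≢y)

  increment : Term
  increment = lam 8 (app succ (var 8))

  compose : Term → Term → Term
  compose W W′ = lam 8 (app W (app W′ (var 8)))

  add2^ : ℕ → Term
  add2^ zero    = increment
  add2^ (suc n) = compose (add2^ n) (add2^ n)

  toTree-node toAdder-node : Term
  toTree-node  = lam 1 (lam 2 (app (app node (var 2)) (var 2)))
  toAdder-node = lam 4 (lam 5 (lam 6 (lam 7 (lam 8 (app (var 6) (app (var 7) (var 8)))))))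

  toTree toAdder : List Term
  toTree  = toTree-node ∷ leaf ∷ []
  toAdder = toAdder-node ∷ increment ∷ []

  Exp : Term
  Exp = lam 0 (app (rec (rec (var 0) toTree) toAdder) ⌜ 0 ⌝)

  increment-closed : Closed increment
  increment-closed = lam-closed λ x≢8 → cong (app succ) (var-subst-≢ x≢8)

  compose-closed : ∀ {W W′} → Closed W → Closed W′ → Closed (compose W W′)
  compose-closed cW cW′ =
    lam-closed λ x≢8 → cong₂ app (cW _ _) (cong₂ app (cW′ _ _) (var-subst-≢ x≢8))

  add2^-closed : ∀ n → Closed (add2^ n)
  add2^-closed zero    = increment-closed
  add2^-closed (suc n) = compose-closed (add2^-closed n) (add2^-closed n)

  add2^-isValue : ∀ n → IsValue (add2^ n)
  add2^-isValue zero    = vLam 8 _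
  add2^-isValue (suc n) = vLam 8 _

  _Adds_ : Term → ℕ → Set
  W Adds k = ∀ m → app W ⌜ m ⌝ ⇝* ⌜ k + m ⌝

  increment-adds : increment Adds 1
  increment-adds m = step (β (vCT (⌜⌝-isCT m))) ◅ ε

  compose-adds : ∀ {W W′ k k′} → Closed W → Closed W′ → W Adds k → W′ Adds k′ →
                 compose W W′ Adds (k + k′)
  compose-adds {W} {W′} {k} {k′} cW cW′ addW addW′ m =
    step (β (vCT (⌜⌝-isCT m)))
    ◅ subst₂ (λ X X′ → app X (app X′ ⌜ m ⌝) ⇝* ⌜ k + k′ + m ⌝) (sym (cW _ 8)) (sym (cW′ _ 8))
        (subst (λ j → app W (app W′ ⌜ m ⌝) ⇝* ⌜ j ⌝) (sym (+-assoc k k′ m))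
          (appR* (addW′ m) ◅◅ addW (k′ + m)))

  add2^-adds : ∀ n → add2^ n Adds (2 ^ n)
  add2^-adds zero    = increment-adds
  add2^-adds (suc n) =
    subst (add2^ (suc n) Adds_) (cong (2 ^ n +_) (sym (+-identityʳ (2 ^ n))))
      (compose-adds (add2^-closed n) (add2^-closed n) (add2^-adds n) (add2^-adds n))

  rec-⌜⌝-toTree : ∀ n → rec ⌜ n ⌝ toTree ⇝* fullTree n
  rec-⌜⌝-toTree zero    = step (ιR {ts = []} refl [] refl refl) ◅ ε
  rec-⌜⌝-toTree (suc n) =
    step (ιR {ts = ⌜ n ⌝ ∷ []} refl (⌜⌝-isCT n ∷ []) refl refl)
    ◅ appL (step (β (vCT (⌜⌝-isCT n))))
    ◅ appR* (rec-⌜⌝-toTree n)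
    ◅◅ step (β (vCT (fullTree-isCT n)))
    ◅ ε

  rec-node-toAdder : ∀ {S T W W′} → IsCT S → IsCT T → IsValue W → IsValue W′ → Closed W →
                     rec S toAdder ⇝* W → rec T toAdder ⇝* W′ →
                     rec (app (app node S) T) toAdder ⇝* compose W W′
  rec-node-toAdder {S} {T} {W} {W′} ctS ctT vW vW′ cW S⇝*W T⇝*W′ =
    step (ιR {ts = S ∷ T ∷ []} refl (ctS ∷ ctT ∷ []) refl refl)
    ◅ appL (appL (appL (step (β (vCT ctS)))))
    ◅ appL (appL (step (β (vCT ctT))))
    ◅ appL* (appR* S⇝*W)
    ◅◅ appL (step (β vW))
    ◅ appR* T⇝*W′
    ◅◅ step β-W′
    ◅ ε
    where
    W∘ : Term
    W∘ = lam 7 (lam 8 (app W (app (var 7) (var 8))))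

    β-W′ : app W∘ W′ ⟶ compose W W′
    β-W′ = subst (app W∘ W′ ⟶_) (cong (λ X → lam 8 (app X (app W′ (var 8)))) (cW W′ 7)) (β vW′)

  rec-fullTree-toAdder : ∀ n → rec (fullTree n) toAdder ⇝* add2^ n
  rec-fullTree-toAdder zero    = step (ιR {ts = []} refl [] refl refl) ◅ ε
  rec-fullTree-toAdder (suc n) =
    rec-node-toAdder (fullTree-isCT n) (fullTree-isCT n) (add2^-isValue n) (add2^-isValue n)
      (add2^-closed n) (rec-fullTree-toAdder n) (rec-fullTree-toAdder n)

  Exp-⇝* : ∀ n → app Exp ⌜ n ⌝ ⇝* ⌜ 2 ^ n ⌝
  Exp-⇝* n =
    step (β (vCT (⌜⌝-isCT n)))
    ◅ appL* (recS* (rec-⌜⌝-toTree n) ◅◅ rec-fullTree-toAdder n)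
    ◅◅ subst (λ j → app (add2^ n) ⌜ 0 ⌝ ⇝* ⌜ j ⌝) (+-identityʳ (2 ^ n)) (add2^-adds n 0)

  fresh : ∀ {x xs} → {False (x ∈? xs)} → x ∉ xs
  fresh {x} {xs} {x∉xs} = toWitnessFalse {a? = x ∈? xs} x∉xs

  wkˡ : ∀ {Γ M B x A} → x ∉ dom Γ → Γ ⊢ M ∶ B → ((x , A) ∷ Γ) ⊢ M ∶ B
  wkˡ {Γ} x∉Γ ⊢M = ex (++-comm Γ _) (wk x∉Γ ⊢M)

  toTree-node-typed : ∀ {m n} → [] ⊢ toTree-node ∶ base 𝕌 m ⊸^[ 1 ] (base ℂ n ⊸^[ 1 ] base ℂ n)
  toTree-node-typed {n = n} =
    lamI (lamI (wkˡ fresh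
      (ctr {Γ = []} {x = 10} {y = 11} (isBase ℂ n) fresh fresh
        (appE (appE conI ax []) ax (fresh ∷ [])))))

  toTree-typed : ∀ {m n} →
    Branches AllBase (λ r → base 𝕌 m ⊸^[ r ] (base ℂ n ⊸^[ r ] base ℂ n)) (arityOf 𝕌) toTree []
  toTree-typed = cons toTree-node-typed [] (cons conI [] [] []) []

  toAdder-node-typed : ∀ {n C} → [] ⊢ toAdder-node ∶ base ℂ n ⊸^[ 2 ] ((C ⊸ C) ⊸^[ 2 ] (C ⊸ C))
  toAdder-node-typed =
    lamI (lamI (lamI (lamI (lamI
      (wkˡ fresh (wkˡ fresh (appE ax (appE ax ax (fresh ∷ [])) (fresh ∷ []))))))))

  increment-typed : ∀ {i} → [] ⊢ increment ∶ base 𝕌 i ⊸ base 𝕌 i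
  increment-typed = lamI (appE conI ax [])

  toAdder-typed : ∀ {n i} →
    Branches AllBase (λ r → base ℂ n ⊸^[ r ] ((base 𝕌 i ⊸ base 𝕌 i) ⊸^[ r ] (base 𝕌 i ⊸ base 𝕌 i)))
             (arityOf ℂ) toAdder []
  toAdder-typed = cons toAdder-node-typed [] (cons increment-typed [] [] []) []

  Exp-typed : ∀ i → [] ⊢ Exp ∶ base 𝕌 (i + 2) ⊸ base 𝕌 i
  Exp-typed i =
    lamI (appE (recE toAdder-typed
                     (recE toTree-typed ax [] (+-monoʳ-< i (n<1+n 1)))
                     [] (⊔-pres-<m i<i+1 i<i+1))
               conI (fresh ∷ []))
    where
    i<i+1 : i < i + 1
    i<i+1 = m<m+n i z<s

lemma9 : (F : Family) → let open Lang F in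
    Σ Term (λ Exp →
      ((n : ℕ) → app Exp ⌜ n ⌝ ⇝* ⌜ 2 ^ n ⌝) ×
      ((i : ℕ) → [] ⊢ Exp ∶ (base 𝕌 (i + 2) ⊸ base 𝕌 i)))
lemma9 F = Exp F , Exp-⇝* F , Exp-typed F
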